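{- Let $P$ be a distribution over $\{0,1\}^n$, let $x_1,\ldots,x_s\in\mathrm{supp}(P)$, and let $Q\subseteq\{1,\ldots,s\}\times\{1,\ldots,n\}$, written as $Q=\bigcup_{i=1}^s(\{i\}\times Q_i)$. Let $G$ be the contradiction graph of $(x_1,\ldots,x_s;Q)$ and $m\ge 1$. If $G$ is not $m$-colorable, then $|\{x_1,\ldots,x_s\}|>m$. If $G$ is $m$-colorable, then there exist a distribution $\hat P$ with $|\mathrm{supp}(\hat P)|\le m$ and $y_1,\ldots,y_s\in\mathrm{supp}(\hat P)$ such that $x_i|_{Q_i}=y_i|_{Q_i}$ for every $1\le i\le s$.
   Context: The contradiction graph of $(x_1,\ldots,x_s;Q)$ has vertex set $\{1,\ldots,s\}$ and an edge $\{i_1,i_2\}$ iff there exists $1\le j\le n$ with $(i_1,j),(i_2,j)\in Q$ and $(x_{i_1})_j\ne(x_{i_2})_j$. For $x\in\{0,1\}^n$ and $I\subseteq\{1,\ldots,n\}$, $x|_I$ denotes the restriction of $x$ to the coordinates in $I$.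
   Formalization: The distributions P and $\hat P$ on {0,1}^n take rational values. -}

module Defs where

open import Data.Nat using (ℕ; zero; suc)
open import Data.Bool using (Bool; true; false)
import Data.Bool as B
open import Data.Fin using (Fin)
open import Data.Fin.Subset using (Subset; _∈_)
open import Data.Vec using (Vec; []; _∷_; lookup)
open import Data.Vec.Properties using (≡-dec)
open import Data.List using (List; []; _∷_; _++_; map; length; filter; deduplicate; tabulate)
open import Data.Rational using (ℚ; 0ℚ; 1ℚ; _+_; _<_; _≤_)
open import Data.Rational.Properties using (_<?_)
open import Data.Product using (Σ; _×_; ∃-syntax)
open import Relation.Binary.PropositionalEquality using (_≡_; _≢_)

Cube : ℕ → Set
Cube n = Vec Bool n

allPoints : (n : ℕ) → List (Cube n)
allPoints zero = [] ∷ []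
allPoints (suc n) = map (false ∷_) (allPoints n) ++ map (true ∷_) (allPoints n)

sumℚ : List ℚ → ℚ
sumℚ [] = 0ℚ
sumℚ (q ∷ qs) = q + sumℚ qs

record Distribution (n : ℕ) : Set where
  field
    prob     : Cube n → ℚ
    nonneg   : ∀ y → 0ℚ ≤ prob y
    total    : sumℚ (map prob (allPoints n)) ≡ 1ℚ
open Distribution public

InSupp : ∀ {n} → Distribution n → Cube n → Set
InSupp P y = 0ℚ < prob P y

suppSize : ∀ {n} → Distribution n → ℕ
suppSize {n} P = length (filter (λ y → 0ℚ <? prob P y) (allPoints n))

numDistinct : ∀ {n s} → (Fin s → Cube n) → ℕ
numDistinct {n} {s} x = length (deduplicate (≡-dec B._≟_) (tabulate x))

ContraEdge : ∀ {n s} → (Fin s → Cube n) → (Fin s → Subset n) → Fin s → Fin s → Set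
ContraEdge x Q i₁ i₂ =
  ∃[ j ] (j ∈ Q i₁ × j ∈ Q i₂ × lookup (x i₁) j ≢ lookup (x i₂) j)

Colorable : ∀ {n s} → (Fin s → Cube n) → (Fin s → Subset n) → ℕ → Set
Colorable {s = s} x Q m =
  Σ (Fin s → Fin m) λ c → ∀ i₁ i₂ → ContraEdge x Q i₁ i₂ → c i₁ ≢ c i₂

AgreeOn : ∀ {n} → Subset n → Cube n → Cube n → Set
AgreeOn I x y = ∀ j → j ∈ I → lookup x j ≡ lookup y j

-- If at most m distinct points occur, coloring each index by its point is proper: indices joined
-- by an edge carry different points. Conversely, from a proper m-coloring build one point per color
-- class, taking at each coordinate j the value of any member of the class that sees j; properness
-- makes this choice irrelevant. The uniform distribution on these m points (with multiplicity) has
-- support of size at most m, which is where 1 ≤ m is needed.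
module Submission where

open import Defs
open import Data.Nat using (ℕ; _≤_; _<_)
open import Data.Fin using (Fin)
open import Data.Fin.Subset using (Subset)
open import Data.Product using (Σ; _×_)
open import Relation.Nullary using (¬_)

import Data.Nat.Properties as ℕ
open import Algebra.Properties.CommutativeSemigroup ℕ.+-commutativeSemigroup using (interchange)
open import Data.Bool using (Bool; false; true; if_then_else_)
import Data.Bool as Bool
open import Data.Empty using (⊥-elim)
open import Data.Fin as Fin using (inject≤)
open import Data.Fin.Subset using (_∈_)
open import Data.Fin.Properties using (any?; inject≤-injective)
open import Data.Fin.Subset.Properties using (_∈?_)
open import Data.List as List using (List; []; _∷_; _++_; map; length; filter; deduplicate; tabulate)
open import Data.List.Membership.Propositional using () renaming (_∈_ to _∈ˡ_)
open import Data.List.Membership.Propositional.Properties using (∈-tabulate⁺; ∈-deduplicate⁺)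
open import Data.List.Properties using (map-++; map-∘; length-tabulate)
open import Data.List.Relation.Unary.Any using (here; there; index)
open import Data.List.Relation.Unary.Any.Properties using (lookup-index)
open import Data.Nat using (zero; suc; _+_; z≤n; s≤s)
open import Data.Nat.ListAction using (sum)
open import Data.Nat.ListAction.Properties using (sum-++)
open import Data.Nat.Properties using (+-mono-≤; m≤n+m; ≤-trans; ≤-reflexive; ≰⇒>)
open import Data.Product using (_,_)
open import Data.Rational using (ℚ; 0ℚ; 1ℚ; 1/_; Positive; NonNegative; nonNegative)
import Data.Rational as ℚ
open import Data.Rational.Properties
  using ( _<?_; +-identityˡ; +-assoc; *-zeroˡ; *-distribʳ-+; *-inverseʳ; <-irrefl
        ; nonNeg+nonNeg⇒nonNeg; pos+nonNeg⇒pos; nonNeg*nonNeg⇒nonNeg; pos*pos⇒pos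
        ; ≤-refl; pos⇒nonZero; pos⇒nonNeg; 1/pos⇒pos; positive⁻¹; nonNegative⁻¹)
open import Data.Vec using (lookup)
import Data.Vec as Vec
open import Data.Vec.Properties using (≡-dec; lookup∘tabulate)
open import Function using (_∘_)
open import Relation.Binary.Definitions using (DecidableEquality)
open import Relation.Binary.PropositionalEquality
open import Relation.Nullary using (yes; no; does)
open import Relation.Nullary.Decidable using (_×-dec_; dec-true; decidable-stable)
open import Relation.Unary using (Decidable)

open ≡-Reasoning

sum-map-++ : {A : Set} (f : A → ℕ) (xs ys : List A) →
             sum (map f (xs ++ ys)) ≡ sum (map f xs) + sum (map f ys)
sum-map-++ f xs ys = trans (cong sum (map-++ f xs ys)) (sum-++ (map f xs) (map f ys))

sum-map-+ : {A : Set} (f g : A → ℕ) (xs : List A) →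
            sum (map (λ z → f z + g z) xs) ≡ sum (map f xs) + sum (map g xs)
sum-map-+ f g [] = refl
sum-map-+ f g (x ∷ xs) = begin
  (f x + g x) + sum (map (λ z → f z + g z) xs)    ≡⟨ cong (f x + g x +_) (sum-map-+ f g xs) ⟩
  (f x + g x) + (sum (map f xs) + sum (map g xs)) ≡⟨ interchange (f x) (g x) (sum (map f xs)) (sum (map g xs)) ⟩
  (f x + sum (map f xs)) + (g x + sum (map g xs)) ∎

sum-map-zero : {A : Set} (xs : List A) → sum (map (λ _ → 0) xs) ≡ 0
sum-map-zero [] = refl
sum-map-zero (_ ∷ xs) = sum-map-zero xs

length-filter≤sum-map : {A : Set} {P : A → Set} (P? : Decidable P) (f : A → ℕ) →
                        (∀ z → P z → 0 < f z) →
                        ∀ xs → length (filter P? xs) ≤ sum (map f xs)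
length-filter≤sum-map P? f P⇒pos [] = z≤n
length-filter≤sum-map P? f P⇒pos (x ∷ xs) with P? x
... | yes px = +-mono-≤ (P⇒pos x px) (length-filter≤sum-map P? f P⇒pos xs)
... | no _   = ≤-trans (length-filter≤sum-map P? f P⇒pos xs) (m≤n+m _ (f x))

_≟ᶜ_ : ∀ {n} → DecidableEquality (Cube n)
_≟ᶜ_ = ≡-dec Bool._≟_

indicator : ∀ {n} → Cube n → Cube n → ℕ
indicator z a = if does (z ≟ᶜ a) then 1 else 0

multiplicity : ∀ {n} → Cube n → List (Cube n) → ℕ
multiplicity z as = sum (map (indicator z) as)

sum-map-allPoints-suc : ∀ {n} (f : Cube (suc n) → ℕ) →
  sum (map f (allPoints (suc n)))
    ≡ sum (map (f ∘ (false Vec.∷_)) (allPoints n)) + sum (map (f ∘ (true Vec.∷_)) (allPoints n))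
sum-map-allPoints-suc {n} f = begin
  sum (map f (map (false Vec.∷_) (allPoints n) ++ map (true Vec.∷_) (allPoints n)))
    ≡⟨ sum-map-++ f (map (false Vec.∷_) (allPoints n)) (map (true Vec.∷_) (allPoints n)) ⟩
  sum (map f (map (false Vec.∷_) (allPoints n))) + sum (map f (map (true Vec.∷_) (allPoints n)))
    ≡⟨ sym (cong₂ (λ u v → sum u + sum v) (map-∘ (allPoints n)) (map-∘ (allPoints n))) ⟩
  sum (map (f ∘ (false Vec.∷_)) (allPoints n)) + sum (map (f ∘ (true Vec.∷_)) (allPoints n)) ∎

sum-indicator-allPoints : ∀ n (a : Cube n) → sum (map (λ z → indicator z a) (allPoints n)) ≡ 1
sum-indicator-allPoints zero Vec.[] = refl
sum-indicator-allPoints (suc n) (false Vec.∷ a) = begin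
  sum (map (λ z → indicator z (false Vec.∷ a)) (allPoints (suc n)))
    ≡⟨ sum-map-allPoints-suc (λ z → indicator z (false Vec.∷ a)) ⟩
  sum (map (λ z → indicator z a) (allPoints n)) + sum (map (λ _ → 0) (allPoints n))
    ≡⟨ cong₂ _+_ (sum-indicator-allPoints n a) (sum-map-zero (allPoints n)) ⟩
  1 ∎
sum-indicator-allPoints (suc n) (true Vec.∷ a) = begin
  sum (map (λ z → indicator z (true Vec.∷ a)) (allPoints (suc n)))
    ≡⟨ sum-map-allPoints-suc (λ z → indicator z (true Vec.∷ a)) ⟩
  sum (map (λ _ → 0) (allPoints n)) + sum (map (λ z → indicator z a) (allPoints n))
    ≡⟨ cong₂ _+_ (sum-map-zero (allPoints n)) (sum-indicator-allPoints n a) ⟩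
  1 ∎

sum-multiplicity-allPoints : ∀ {n} (as : List (Cube n)) →
                             sum (map (λ z → multiplicity z as) (allPoints n)) ≡ length as
sum-multiplicity-allPoints {n} [] = sum-map-zero (allPoints n)
sum-multiplicity-allPoints {n} (a ∷ as) = begin
  sum (map (λ z → indicator z a + multiplicity z as) (allPoints n))
    ≡⟨ sum-map-+ (λ z → indicator z a) (λ z → multiplicity z as) (allPoints n) ⟩
  sum (map (λ z → indicator z a) (allPoints n)) + sum (map (λ z → multiplicity z as) (allPoints n))
    ≡⟨ cong₂ _+_ (sum-indicator-allPoints n a) (sum-multiplicity-allPoints as) ⟩
  suc (length as) ∎

∈⇒multiplicity-pos : ∀ {n} {a : Cube n} {as} → a ∈ˡ as → 0 < multiplicity a as
∈⇒multiplicity-pos {a = a} (here refl) rewrite dec-true (a ≟ᶜ a) refl = s≤s z≤n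
∈⇒multiplicity-pos {a = a} {b ∷ _} (there a∈as) =
  ≤-trans (∈⇒multiplicity-pos a∈as) (m≤n+m _ (indicator a b))

ℕ→ℚ : ℕ → ℚ
ℕ→ℚ zero = 0ℚ
ℕ→ℚ (suc k) = 1ℚ ℚ.+ ℕ→ℚ k

ℕ→ℚ-+ : ∀ a b → ℕ→ℚ (a + b) ≡ ℕ→ℚ a ℚ.+ ℕ→ℚ b
ℕ→ℚ-+ zero b = sym (+-identityˡ (ℕ→ℚ b))
ℕ→ℚ-+ (suc a) b = trans (cong (1ℚ ℚ.+_) (ℕ→ℚ-+ a b)) (sym (+-assoc 1ℚ (ℕ→ℚ a) (ℕ→ℚ b)))

ℕ→ℚ-nonNeg : ∀ k → NonNegative (ℕ→ℚ k)
ℕ→ℚ-nonNeg zero = nonNegative ≤-refl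
ℕ→ℚ-nonNeg (suc k) = nonNeg+nonNeg⇒nonNeg 1ℚ (ℕ→ℚ k) {{ℕ→ℚ-nonNeg k}}

ℕ→ℚ-suc-pos : ∀ k → Positive (ℕ→ℚ (suc k))
ℕ→ℚ-suc-pos k = pos+nonNeg⇒pos 1ℚ (ℕ→ℚ k) {{ℕ→ℚ-nonNeg k}}

sumℚ-map-ℕ→ℚ-* : {A : Set} (f : A → ℕ) (w : ℚ) (xs : List A) →
                  sumℚ (map (λ z → ℕ→ℚ (f z) ℚ.* w) xs) ≡ ℕ→ℚ (sum (map f xs)) ℚ.* w
sumℚ-map-ℕ→ℚ-* f w [] = sym (*-zeroˡ w)
sumℚ-map-ℕ→ℚ-* f w (x ∷ xs) = begin
  ℕ→ℚ (f x) ℚ.* w ℚ.+ sumℚ (map (λ z → ℕ→ℚ (f z) ℚ.* w) xs)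
    ≡⟨ cong (ℕ→ℚ (f x) ℚ.* w ℚ.+_) (sumℚ-map-ℕ→ℚ-* f w xs) ⟩
  ℕ→ℚ (f x) ℚ.* w ℚ.+ ℕ→ℚ (sum (map f xs)) ℚ.* w
    ≡⟨ sym (*-distribʳ-+ w (ℕ→ℚ (f x)) _) ⟩
  (ℕ→ℚ (f x) ℚ.+ ℕ→ℚ (sum (map f xs))) ℚ.* w
    ≡⟨ cong (ℚ._* w) (sym (ℕ→ℚ-+ (f x) _)) ⟩
  ℕ→ℚ (f x + sum (map f xs)) ℚ.* w ∎

ℕ→ℚ-*-pos⇒pos : ∀ k w → 0ℚ ℚ.< ℕ→ℚ k ℚ.* w → 0 < k
ℕ→ℚ-*-pos⇒pos zero w 0<0*w = ⊥-elim (<-irrefl refl (subst (0ℚ ℚ.<_) (*-zeroˡ w) 0<0*w))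
ℕ→ℚ-*-pos⇒pos (suc k) w _ = s≤s z≤n

module _ {n m : ℕ} (p : Fin (suc m) → Cube n) where

  private
    sample : List (Cube n)
    sample = tabulate p

    instance
      sampleSize-pos : Positive (ℕ→ℚ (suc m))
      sampleSize-pos = ℕ→ℚ-suc-pos m

    weight : ℚ
    weight = (1/ ℕ→ℚ (suc m)) {{pos⇒nonZero (ℕ→ℚ (suc m))}}

    weight-pos : Positive weight
    weight-pos = 1/pos⇒pos (ℕ→ℚ (suc m))

    frequency : Cube n → ℚ
    frequency z = ℕ→ℚ (multiplicity z sample) ℚ.* weight

  empirical : Distribution n
  empirical = record
    { prob   = frequency
    ; nonneg = λ z → let k = multiplicity z sample in
                 nonNegative⁻¹ (frequency z)
                   {{nonNeg*nonNeg⇒nonNeg (ℕ→ℚ k) {{ℕ→ℚ-nonNeg k}} weight {{pos⇒nonNeg weight {{weight-pos}}}}}}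
    ; total  = begin
        sumℚ (map frequency (allPoints n))
          ≡⟨ sumℚ-map-ℕ→ℚ-* (λ z → multiplicity z sample) weight (allPoints n) ⟩
        ℕ→ℚ (sum (map (λ z → multiplicity z sample) (allPoints n))) ℚ.* weight
          ≡⟨ cong (λ k → ℕ→ℚ k ℚ.* weight)
                  (trans (sum-multiplicity-allPoints sample) (length-tabulate p)) ⟩
        ℕ→ℚ (suc m) ℚ.* weight
          ≡⟨ *-inverseʳ (ℕ→ℚ (suc m)) {{pos⇒nonZero (ℕ→ℚ (suc m))}} ⟩
        1ℚ ∎
    }

  empirical-suppSize : suppSize empirical ≤ suc m
  empirical-suppSize =
    ≤-trans (length-filter≤sum-map (λ z → 0ℚ <? frequency z) (λ z → multiplicity z sample)
                                   (λ z → ℕ→ℚ-*-pos⇒pos (multiplicity z sample) weight) (allPoints n))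
            (≤-reflexive (trans (sum-multiplicity-allPoints sample) (length-tabulate p)))

  empirical-supp : ∀ k → InSupp empirical (p k)
  empirical-supp k with multiplicity (p k) sample | ∈⇒multiplicity-pos {as = sample} (∈-tabulate⁺ {f = p} k)
  ... | zero  | ()
  ... | suc c | _ = positive⁻¹ _ {{pos*pos⇒pos (ℕ→ℚ (suc c)) {{ℕ→ℚ-suc-pos c}} weight {{weight-pos}}}}

ProperColoring : ∀ {n s m} → (Fin s → Cube n) → (Fin s → Subset n) → (Fin s → Fin m) → Set
ProperColoring x Q c = ∀ i₁ i₂ → ContraEdge x Q i₁ i₂ → c i₁ ≢ c i₂

module _ {n s m : ℕ} (x : Fin s → Cube n) (Q : Fin s → Subset n) {c : Fin s → Fin m} where

  point-determined⇒proper : (∀ {i₁ i₂} → c i₁ ≡ c i₂ → x i₁ ≡ x i₂) → ProperColoring x Q c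
  point-determined⇒proper c⇒x i₁ i₂ (j , _ , _ , x₁≢x₂) c₁≡c₂ = x₁≢x₂ (cong (λ v → lookup v j) (c⇒x c₁≡c₂))

  proper⇒same-color-agree : ProperColoring x Q c → ∀ {i₁ i₂ j} → c i₁ ≡ c i₂ →
                             j ∈ Q i₁ → j ∈ Q i₂ →
                             lookup (x i₁) j ≡ lookup (x i₂) j
  proper⇒same-color-agree proper {i₁} {i₂} {j} c₁≡c₂ j∈₁ j∈₂ =
    decidable-stable (lookup (x i₁) j Bool.≟ lookup (x i₂) j)
                     (λ x₁≢x₂ → proper i₁ i₂ (j , j∈₁ , j∈₂ , x₁≢x₂) c₁≡c₂)

numDistinct≤⇒colorable : ∀ {n s m} (x : Fin s → Cube n) (Q : Fin s → Subset n) →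
                         numDistinct x ≤ m → Colorable x Q m
numDistinct≤⇒colorable {n} {s} {m} x Q d≤m = color , point-determined⇒proper x Q same-color⇒same-point
  where
  distinct : List (Cube n)
  distinct = deduplicate _≟ᶜ_ (tabulate x)

  x∈distinct : ∀ i → x i ∈ˡ distinct
  x∈distinct i = ∈-deduplicate⁺ _≟ᶜ_ (∈-tabulate⁺ i)

  color : Fin s → Fin m
  color i = inject≤ (index (x∈distinct i)) d≤m

  same-color⇒same-point : ∀ {i₁ i₂} → color i₁ ≡ color i₂ → x i₁ ≡ x i₂
  same-color⇒same-point {i₁} {i₂} eq = begin
    x i₁                                         ≡⟨ lookup-index (x∈distinct i₁) ⟩
    List.lookup distinct (index (x∈distinct i₁)) ≡⟨ cong (List.lookup distinct) (inject≤-injective d≤m d≤m _ _ eq) ⟩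
    List.lookup distinct (index (x∈distinct i₂)) ≡⟨ sym (lookup-index (x∈distinct i₂)) ⟩
    x i₂                                         ∎

module _ {n s m : ℕ} (x : Fin s → Cube n) (Q : Fin s → Subset n) (c : Fin s → Fin m) where

  -- For a proper coloring, all points of color k whose index sees coordinate j agree there;
  -- false when there is no such point.
  classValue : Fin m → Fin n → Bool
  classValue k j with any? (λ i → (c i Fin.≟ k) ×-dec (j ∈? Q i))
  ... | yes (i , _) = lookup (x i) j
  ... | no _        = false

  representative : Fin m → Cube n
  representative k = Vec.tabulate (classValue k)

  proper⇒classValue : ProperColoring x Q c → ∀ i j → j ∈ Q i →
                      classValue (c i) j ≡ lookup (x i) j
  proper⇒classValue proper i j j∈Qi with any? (λ i′ → (c i′ Fin.≟ c i) ×-dec (j ∈? Q i′))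
  ... | yes (i′ , c′≡c , j∈Qi′) = proper⇒same-color-agree x Q proper c′≡c j∈Qi′ j∈Qi
  ... | no ∄i′                  = ⊥-elim (∄i′ (i , refl , j∈Qi))

  proper⇒representative-agrees : ProperColoring x Q c → ∀ i → AgreeOn (Q i) (x i) (representative (c i))
  proper⇒representative-agrees proper i j j∈Qi =
    trans (sym (proper⇒classValue proper i j j∈Qi)) (sym (lookup∘tabulate (classValue (c i)) j))

lemma3p32 : ∀ {n s : ℕ} (P : Distribution n) (x : Fin s → Cube n)
              → (∀ i → InSupp P (x i))
              → (Q : Fin s → Subset n) (m : ℕ) → 1 ≤ m
              → (¬ Colorable x Q m → m < numDistinct x)
                × (Colorable x Q m →
                    Σ (Distribution n) λ P̂ → suppSize P̂ ≤ m
                      × Σ (Fin s → Cube n) λ y → (∀ i → InSupp P̂ (y i))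
                        × (∀ i → AgreeOn (Q i) (x i) (y i)))
lemma3p32 {n} {s} P x _ Q (suc m) _ = not-colorable , colorable
  where
  not-colorable : ¬ Colorable x Q (suc m) → suc m < numDistinct x
  not-colorable ¬col = ≰⇒> (¬col ∘ numDistinct≤⇒colorable x Q)

  colorable : Colorable x Q (suc m) →
              Σ (Distribution n) λ P̂ → suppSize P̂ ≤ suc m
                × Σ (Fin s → Cube n) λ y → (∀ i → InSupp P̂ (y i))
                  × (∀ i → AgreeOn (Q i) (x i) (y i))
  colorable (c , proper) =
    empirical ŷ , empirical-suppSize ŷ ,
    ŷ ∘ c , empirical-supp ŷ ∘ c , proper⇒representative-agrees x Q c proper
    where
    ŷ : Fin (suc m) → Cube n
    ŷ = representative x Q c
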